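{- Let $G$ be a graph of girth at least five, let $k\ge 1$, and let $I_s, I_t$ be independent sets of $G$ of size $k$. Let $L_1 = I_s \cup I_t$, $L_2 = N_G(L_1)$ and $L_3 = V(G)\setminus(L_1\cup L_2)$. If $u \in L_2 \cup L_3$, then $u$ has at most $|L_1| \le 2k$ neighbors in $L_1 \cup L_2$, i.e., $|N_G(u)\cap(L_1\cup L_2)| \le |L_1| \le 2k$.
   Context: For a set $Q$ of vertices, $N_G(Q) = \{v \notin Q : \{u,v\}\in E(G) \text{ for some } u \in Q\}$. The girth of a graph is the length of its shortest cycle. -}

module Defs where

open import Data.Nat using (ℕ; zero; suc; _≤_)
open import Data.Fin using (Fin; zero; suc; toℕ; fromℕ)
open import Data.Fin.Subset using (Subset; _∈_; _∉_)
open import Data.Fin.Properties using (any?)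
open import Data.Fin.Subset.Properties using (_∈?_)
open import Data.Bool using (Bool; not; _∧_)
open import Data.Vec using (tabulate)
open import Data.Product using (Σ; _×_; ∃)
open import Data.Empty using (⊥)
open import Relation.Nullary using (¬_; does)
open import Relation.Nullary.Decidable using (_×-dec_)
open import Relation.Binary using (Rel; Decidable; Symmetric; Irreflexive)
open import Relation.Binary.PropositionalEquality using (_≡_)
open import Function.Definitions using (Injective)
open import Level using (0ℓ)

record Graph (n : ℕ) : Set₁ where
  field
    Adj   : Rel (Fin n) 0ℓ
    adj?  : Decidable Adj
    sym   : Symmetric Adj
    irr   : Irreflexive _≡_ Adj
open Graph public

Cycle : ∀ {n} → Graph n → ℕ → Set
Cycle {n} G zero    = ⊥
Cycle {n} G (suc m) =
  Σ (Fin (suc m) → Fin n) λ f →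
    Injective _≡_ _≡_ f
    × 3 ≤ suc m
    × (∀ i j → suc (toℕ i) ≡ toℕ j → Adj G (f i) (f j))
    × Adj G (f (fromℕ m)) (f zero)

-- Girth at least g: every cycle has length at least g
-- (acyclic graphs have infinite girth and qualify).
GirthAtLeast : ∀ {n} → Graph n → ℕ → Set
GirthAtLeast G g = ∀ ℓ → Cycle G ℓ → g ≤ ℓ

Independent : ∀ {n} → Graph n → Subset n → Set
Independent G I = ∀ u v → u ∈ I → v ∈ I → ¬ Adj G u v

-- N_G(Q) = { v ∉ Q : {u,v} ∈ E(G) for some u ∈ Q }
N : ∀ {n} → Graph n → Subset n → Subset n
N G Q = tabulate λ v → not (does (v ∈? Q)) ∧ does (any? (λ u → (u ∈? Q) ×-dec adj? G u v))

-- Send each neighbour w of u in L₁ ∪ N(L₁) to a vertex of L₁ that dominates it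
-- (w itself, or a neighbour of w in L₁).  This is injective when the girth is at
-- least five: two neighbours of u dominated by the same x ≠ u close a triangle
-- or a 4-cycle through u and x.
module Submission where

open import Defs hiding (sym)
open import Data.Nat using (ℕ; suc; _+_; _*_; _≤_; _<_; z≤n; s≤s)
open import Data.Nat.Properties as ℕ using (module ≤-Reasoning)
open import Data.Fin using (Fin; zero; suc; toℕ; fromℕ; inject₁; _≟_)
open import Data.Fin.Properties using (toℕ-injective; toℕ-inject₁; any?)
open import Data.Fin.Subset
  using (Subset; inside; outside; _∈_; _∉_; _⊆_; _⊂_; _∪_; _∩_; _─_; _-_; ∁; ⁅_⁆; ∣_∣)
open import Data.Fin.Subset.Properties
open import Data.Fin.Subset.Induction using (⊂-wellFounded)
open import Induction.WellFounded using (Acc; acc)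
open import Data.Vec using (Vec; []; _∷_; here; there; lookup)
open import Data.Vec.Properties using (lookup∘tabulate; []=⇒lookup)
open import Data.Vec.Relation.Unary.All using ([]; _∷_)
open import Data.Vec.Relation.Unary.Unique.Propositional using (Unique; []; _∷_)
open import Data.Vec.Relation.Unary.Unique.Propositional.Properties using (lookup-injective)
open import Data.Bool using (true; _∧_; not)
open import Data.Product using (_×_; _,_; proj₁; proj₂; ∃-syntax)
open import Data.Sum using (_⊎_; inj₁; inj₂)
open import Function using (_∘_)
open import Relation.Nullary using (¬_; yes; no; does; Dec; contradiction)
open import Relation.Nullary.Decidable using (_×-dec_)
open import Relation.Binary.PropositionalEquality
  using (_≡_; _≢_; refl; sym; trans; cong; cong₂; subst)

private
  variable
    n : ℕ

∣p∪q∣≤∣p∣+∣q∣ : ∀ (p q : Subset n) → ∣ p ∪ q ∣ ≤ ∣ p ∣ + ∣ q ∣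
∣p∪q∣≤∣p∣+∣q∣ []            []            = z≤n
∣p∪q∣≤∣p∣+∣q∣ (inside  ∷ p) (s       ∷ q) =
  s≤s (ℕ.≤-trans (∣p∪q∣≤∣p∣+∣q∣ p q) (ℕ.+-monoʳ-≤ ∣ p ∣ (∣p∣≤∣x∷p∣ s q)))
∣p∪q∣≤∣p∣+∣q∣ (outside ∷ p) (inside  ∷ q) =
  ℕ.≤-trans (s≤s (∣p∪q∣≤∣p∣+∣q∣ p q)) (ℕ.≤-reflexive (sym (ℕ.+-suc ∣ p ∣ ∣ q ∣)))
∣p∪q∣≤∣p∣+∣q∣ (outside ∷ p) (outside ∷ q) = ∣p∪q∣≤∣p∣+∣q∣ p q

x∈p─q⇒x∉q : ∀ {x : Fin n} (p q : Subset n) → x ∈ p ─ q → x ∉ q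
x∈p─q⇒x∉q (inside ∷ p) (outside ∷ q) here       ()
x∈p─q⇒x∉q (_      ∷ p) (_       ∷ q) (there x∈) (there y∈) = x∈p─q⇒x∉q p q x∈ y∈

x∈p-y⇒x≢y : ∀ {x y : Fin n} {p : Subset n} → x ∈ p - y → x ≢ y
x∈p-y⇒x≢y {y = y} {p} x∈ = x∉⁅y⁆⇒x≢y (x∈p─q⇒x∉q p ⁅ y ⁆ x∈)

x∈p⇒∣p∣≡1+∣p-x∣ : ∀ {x : Fin n} {p : Subset n} → x ∈ p → ∣ p ∣ ≡ suc ∣ p - x ∣
x∈p⇒∣p∣≡1+∣p-x∣ {p = inside  ∷ p} here        = cong (λ r → suc ∣ r ∣) (sym (p─⊥≡p p))
x∈p⇒∣p∣≡1+∣p-x∣ {p = inside  ∷ p} (there x∈p) = cong suc (x∈p⇒∣p∣≡1+∣p-x∣ x∈p)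
x∈p⇒∣p∣≡1+∣p-x∣ {p = outside ∷ p} (there x∈p) = x∈p⇒∣p∣≡1+∣p-x∣ x∈p

module _ {n : ℕ} where

  private
    injection-acc : ∀ {p : Subset n} → Acc _⊂_ p → ∀ {q : Subset n}
      (f : ∀ {x} → x ∈ p → Fin n) → (∀ {x} (x∈p : x ∈ p) → f x∈p ∈ q) →
      (∀ {x y} (x∈p : x ∈ p) (y∈p : y ∈ p) → f x∈p ≡ f y∈p → x ≡ y) →
      ∣ p ∣ ≤ ∣ q ∣
    injection-acc {p} (acc rec) {q} f f∈q f-inj with nonempty? p
    ... | no p-empty = p⊆q⇒∣p∣≤∣q∣ {q = q} (λ x∈p → contradiction (_ , x∈p) p-empty)
    ... | yes (x , x∈p) = begin
      ∣ p ∣              ≡⟨ x∈p⇒∣p∣≡1+∣p-x∣ x∈p ⟩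
      suc ∣ p - x ∣       ≤⟨ s≤s (injection-acc (rec (x∈p⇒p-x⊂p x∈p)) f′ f′∈q′ f′-inj) ⟩
      suc ∣ q - f x∈p ∣   ≡⟨ sym (x∈p⇒∣p∣≡1+∣p-x∣ (f∈q x∈p)) ⟩
      ∣ q ∣              ∎
      where
      open ≤-Reasoning
      p-x⊆p : p - x ⊆ p
      p-x⊆p = p─q⊆p p ⁅ x ⁆
      f′ : ∀ {y} → y ∈ p - x → Fin n
      f′ y∈ = f (p-x⊆p y∈)
      f′∈q′ : ∀ {y} (y∈ : y ∈ p - x) → f′ y∈ ∈ q - f x∈p
      f′∈q′ y∈ = x∈p∧x≢y⇒x∈p-y (f∈q (p-x⊆p y∈))
        (λ fy≡fx → x∈p-y⇒x≢y y∈ (f-inj (p-x⊆p y∈) x∈p fy≡fx))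
      f′-inj : ∀ {y z} (y∈ : y ∈ p - x) (z∈ : z ∈ p - x) → f′ y∈ ≡ f′ z∈ → y ≡ z
      f′-inj y∈ z∈ = f-inj (p-x⊆p y∈) (p-x⊆p z∈)

  injection⇒∣p∣≤∣q∣ : ∀ {p q : Subset n}
    (f : ∀ {x} → x ∈ p → Fin n) → (∀ {x} (x∈p : x ∈ p) → f x∈p ∈ q) →
    (∀ {x y} (x∈p : x ∈ p) (y∈p : y ∈ p) → f x∈p ≡ f y∈p → x ≡ y) →
    ∣ p ∣ ≤ ∣ q ∣
  injection⇒∣p∣≤∣q∣ {p} = injection-acc (⊂-wellFounded p)

∈N⁻ : ∀ (G : Graph n) {Q : Subset n} {w : Fin n} →
      w ∈ N G Q → w ∉ Q × ∃[ x ] (x ∈ Q × Adj G x w)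
∈N⁻ G {Q} {w} w∈NQ = go (w ∈? Q) (any? λ x → (x ∈? Q) ×-dec adj? G x w)
  (trans (sym (lookup∘tabulate _ w)) ([]=⇒lookup w∈NQ))
  where
  -- the remaining cases reduce the last argument to false ≡ true
  go : (w∈Q? : Dec (w ∈ Q)) (nbr? : Dec (∃[ x ] (x ∈ Q × Adj G x w))) →
       not (does w∈Q?) ∧ does nbr? ≡ true → w ∉ Q × ∃[ x ] (x ∈ Q × Adj G x w)
  go (no w∉Q) (yes nbr) _ = w∉Q , nbr

module _ {n : ℕ} (G : Graph n) where

  adjacent⇒≢ : ∀ {a b} → Adj G a b → a ≢ b
  adjacent⇒≢ ab a≡b = irr G a≡b ab

  closedPath⇒Cycle : ∀ {m} (vs : Vec (Fin n) (suc m)) → Unique vs → 3 ≤ suc m →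
    (∀ (i : Fin m) → Adj G (lookup vs (inject₁ i)) (lookup vs (suc i))) →
    Adj G (lookup vs (fromℕ m)) (lookup vs zero) → Cycle G (suc m)
  closedPath⇒Cycle vs distinct 3≤ step close =
    lookup vs , (λ {i} {j} → lookup-injective distinct i j) , 3≤ , step′ , close
    where
    step′ : ∀ i j → suc (toℕ i) ≡ toℕ j → Adj G (lookup vs i) (lookup vs j)
    step′ i (suc j) i+1≡j+1 = subst (λ k → Adj G (lookup vs k) (lookup vs (suc j))) (sym i≡j) (step j)
      where
      i≡j : i ≡ inject₁ j
      i≡j = toℕ-injective (trans (ℕ.suc-injective i+1≡j+1) (sym (toℕ-inject₁ j)))

  triangle : ∀ {a b c} → Adj G a b → Adj G b c → Adj G c a → Cycle G 3
  triangle ab bc ca = closedPath⇒Cycle (_ ∷ _ ∷ _ ∷ [])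
    ((adjacent⇒≢ ab ∷ (adjacent⇒≢ ca ∘ sym) ∷ []) ∷ (adjacent⇒≢ bc ∷ []) ∷ [] ∷ [])
    (s≤s (s≤s (s≤s z≤n)))
    (λ { zero → ab ; (suc zero) → bc })
    ca

  square : ∀ {a b c d} → Adj G a b → Adj G b c → Adj G c d → Adj G d a →
           a ≢ c → b ≢ d → Cycle G 4
  square ab bc cd da a≢c b≢d = closedPath⇒Cycle (_ ∷ _ ∷ _ ∷ _ ∷ [])
    ( (adjacent⇒≢ ab ∷ a≢c ∷ (adjacent⇒≢ da ∘ sym) ∷ [])
    ∷ (adjacent⇒≢ bc ∷ b≢d ∷ [])
    ∷ (adjacent⇒≢ cd ∷ [])
    ∷ [] ∷ [])
    (s≤s (s≤s (s≤s z≤n)))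
    (λ { zero → ab ; (suc zero) → bc ; (suc (suc zero)) → cd })
    da

  girth>ℓ⇒¬Cycle : ∀ {g ℓ} → GirthAtLeast G g → ℓ < g → ¬ Cycle G ℓ
  girth>ℓ⇒¬Cycle girth ℓ<g cycle = ℕ.<⇒≱ ℓ<g (girth _ cycle)

  Dominates : Fin n → Fin n → Set
  Dominates x w = x ≡ w ⊎ Adj G x w

  ∈∪N⁻ : ∀ {Q : Subset n} {w} → w ∈ Q ∪ N G Q → ∃[ x ] (x ∈ Q × Dominates x w)
  ∈∪N⁻ {Q} {w} w∈ with x∈p∪q⁻ Q (N G Q) w∈
  ... | inj₁ w∈Q  = w , w∈Q , inj₁ refl
  ... | inj₂ w∈NQ = let (x , x∈Q , xw) = proj₂ (∈N⁻ G w∈NQ) in x , x∈Q , inj₂ xw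

  ∈N⁅u⁆⁻ : ∀ {u w} → w ∈ N G ⁅ u ⁆ → Adj G u w
  ∈N⁅u⁆⁻ {u} {w} w∈ = let (x , x∈⁅u⁆ , xw) = proj₂ (∈N⁻ G w∈) in
    subst (λ v → Adj G v w) (x∈⁅y⁆⇒x≡y u x∈⁅u⁆) xw

  module _ (girth : GirthAtLeast G 5) where

    no-triangle : ¬ Cycle G 3
    no-triangle = girth>ℓ⇒¬Cycle girth (ℕ.m<n⇒m<1+n (ℕ.n<1+n 3))

    no-square : ¬ Cycle G 4
    no-square = girth>ℓ⇒¬Cycle girth (ℕ.n<1+n 4)

    dominates-unique-neighbour : ∀ {u x y z} → x ≢ u → Adj G u y → Adj G u z →
      Dominates x y → Dominates x z → y ≡ z
    dominates-unique-neighbour _ _ _ (inj₁ refl) (inj₁ refl) = refl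
    dominates-unique-neighbour _ uy uz (inj₁ refl) (inj₂ yz) =
      contradiction (triangle uy yz (Graph.sym G uz)) no-triangle
    dominates-unique-neighbour _ uy uz (inj₂ zy) (inj₁ refl) =
      contradiction (triangle uz zy (Graph.sym G uy)) no-triangle
    dominates-unique-neighbour {y = y} {z} x≢u uy uz (inj₂ xy) (inj₂ xz) with y ≟ z
    ... | yes y≡z = y≡z
    ... | no  y≢z = contradiction
      (square uy (Graph.sym G xy) xz (Graph.sym G uz) (x≢u ∘ sym) y≢z) no-square

    ∣N⁅u⁆∩[Q∪NQ]∣≤∣Q∣ : ∀ {Q : Subset n} {u} → u ∉ Q →
      ∣ N G ⁅ u ⁆ ∩ (Q ∪ N G Q) ∣ ≤ ∣ Q ∣
    ∣N⁅u⁆∩[Q∪NQ]∣≤∣Q∣ {Q} {u} u∉Q =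
      injection⇒∣p∣≤∣q∣ (proj₁ ∘ dominator) (proj₁ ∘ proj₂ ∘ dominator) dominator-injective
      where
      A : Subset n
      A = N G ⁅ u ⁆ ∩ (Q ∪ N G Q)
      dominator : ∀ {w} → w ∈ A → ∃[ x ] (x ∈ Q × Dominates x w)
      dominator w∈A = ∈∪N⁻ (proj₂ (x∈p∩q⁻ (N G ⁅ u ⁆) _ w∈A))
      neighbour : ∀ {w} → w ∈ A → Adj G u w
      neighbour w∈A = ∈N⁅u⁆⁻ (proj₁ (x∈p∩q⁻ (N G ⁅ u ⁆) _ w∈A))
      dominator-injective : ∀ {y z} (y∈A : y ∈ A) (z∈A : z ∈ A) →
        proj₁ (dominator y∈A) ≡ proj₁ (dominator z∈A) → y ≡ z
      dominator-injective y∈A z∈A same with dominator y∈A | dominator z∈A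
      ... | x , x∈Q , xy | _ , _ , xz with refl ← same =
        dominates-unique-neighbour (λ { refl → u∉Q x∈Q }) (neighbour y∈A) (neighbour z∈A) xy xz

lemma2 : ∀ {n} (G : Graph n) → GirthAtLeast G 5 →
         (k : ℕ) → 1 ≤ k →
         (Is It : Subset n) → Independent G Is → Independent G It →
         ∣ Is ∣ ≡ k → ∣ It ∣ ≡ k →
         let L₁ = Is ∪ It
             L₂ = N G L₁
             L₃ = ∁ (L₁ ∪ L₂)
         in (u : Fin n) → (u ∈ L₂ ⊎ u ∈ L₃) →
            (∣ N G ⁅ u ⁆ ∩ (L₁ ∪ L₂) ∣ ≤ ∣ L₁ ∣) × (∣ L₁ ∣ ≤ 2 * k)
lemma2 G girth k _ Is It _ _ ∣Is∣≡k ∣It∣≡k u u∈L₂⊎L₃ =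
  ∣N⁅u⁆∩[Q∪NQ]∣≤∣Q∣ G girth (u∉L₁ u∈L₂⊎L₃) , ∣L₁∣≤2k
  where
  open ≤-Reasoning
  L₁ : Subset _
  L₁ = Is ∪ It
  u∉L₁ : u ∈ N G L₁ ⊎ u ∈ ∁ (L₁ ∪ N G L₁) → u ∉ L₁
  u∉L₁ (inj₁ u∈L₂) = proj₁ (∈N⁻ G u∈L₂)
  u∉L₁ (inj₂ u∈L₃) = x∈∁p⇒x∉p u∈L₃ ∘ p⊆p∪q (N G L₁)
  ∣L₁∣≤2k : ∣ L₁ ∣ ≤ 2 * k
  ∣L₁∣≤2k = begin
    ∣ Is ∪ It ∣      ≤⟨ ∣p∪q∣≤∣p∣+∣q∣ Is It ⟩
    ∣ Is ∣ + ∣ It ∣  ≡⟨ cong₂ _+_ ∣Is∣≡k ∣It∣≡k ⟩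
    k + k            ≡⟨ cong (k +_) (sym (ℕ.+-identityʳ k)) ⟩
    2 * k            ∎
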